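{- Let $p,q\in\mathbb{Z}$, let $(G_n)_{n\ge0}$ be defined by $G_0=0$, $G_1=1$ and $G_n=pG_{n-1}+qG_{n-2}$ for $n\ge2$, let $r=p^2+4q\neq0$, and let $s$ be a positive integer. Suppose that one of the following holds: (a) $p$ is odd, $\gcd(p,q)=1$ and $s\mid r$; or (b) $p$ is even, $\gcd(p/2,q)=1$ and $s\mid r/4$; or (c) $\gcd(p,q)=1$ and $s$ is a prime with $s\mid r$. Then: (1) For all integers $n\ge0$: $s\mid n$ if and only if $s\mid G_n$. (2) If for every positive integer $t$, $s\nmid t$ implies $s^2\nmid G_{st}$, then for all integers $k,n\ge0$: $s^k\mid n$ if and only if $s^k\mid G_n$.
   Context: For integers $a,b$, $a\mid b$ means there is an integer $c$ with $b=ca$ (in particular $0\mid 0$); $\gcd$ denotes the greatest common divisor. -}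

module Defs where

open import Data.Nat using (ℕ; zero; suc)
open import Data.Integer using (ℤ; +_; _+_; _*_)

G : ℤ → ℤ → ℕ → ℤ
G p q zero = + 0
G p q (suc zero) = + 1
G p q (suc (suc n)) = p * G p q (suc n) + q * G p q n

module Submission where

-- Each of the cases (a), (b), (c) provides a DOUBLE ROOT c of
-- X² − pX − q modulo s (s ∣ 2c − p and s ∣ q + c²) which is a unit modulo s.
-- Whenever c is a double root of X² − PX − Q modulo M, the Lucas sequence
-- satisfies G_{n+1} ≡ (n+1)c^n (mod M), as for (X − c)²; with M = s and c a
-- unit this is part (1).  For part (2): (G_{jm})_j is G_m times the Lucas
-- sequence with parameters P′ = 2G_{m+1} − pG_m, Q′ = −(G_{m+1}² − pG_{m+1}G_m − qG_m²),
-- and if s ∣ G_m then G_{m+1} − cG_m is a double root of X² − P′X − Q′ modulo s².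
-- The congruence modulo s² gives G_{sm} = G_m · s · U with U a unit, hence
-- G_{s^k m} = G_m · s^k · U.  With m = st this yields s^k ∣ n ⇒ s^k ∣ G_n, and
-- with the hypothesis s² ∤ G_{st} for s ∤ t the converse by induction on k.

open import Defs
open import Data.Nat as ℕ using (ℕ; zero; suc; _^_; z≤n; s≤s) renaming (_≤_ to _≤ℕ_; _*_ to _*ℕ_)
import Data.Nat.Properties as ℕP
open import Data.Nat.Divisibility as ℕD using () renaming (_∣_ to _∣ℕ_)
open import Data.Nat.Coprimality as Coprimality using (Coprime)
open import Data.Nat.Primality using (Prime; euclidsLemma; prime[2]; prime⇒irreducible)
import Data.Nat.Tactic.RingSolver as ℕSolver
open import Data.Integer as ℤ using (ℤ; +_; _+_; _*_; -_; _-_; ∣_∣; _/ℕ_; _%ℕ_)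
import Data.Integer.Properties as ℤP
import Data.Integer.DivMod as ℤD
open import Data.Integer.Divisibility using (_∣_)
open import Data.Integer.Divisibility.Signed as Signed using (divides) renaming (_∣_ to _∣ₛ_)
open import Data.Integer.GCD using (gcd; gcd-greatest)
open import Data.Integer.Tactic.RingSolver using (solve-∀)
open import Data.Product using (_×_; _,_; proj₁; proj₂; Σ-syntax)
open import Data.Sum using (_⊎_; inj₁; inj₂; reduce)
open import Function.Bundles using (_⇔_; mk⇔; Equivalence)
open import Relation.Nullary using (¬_; yes; no; contradiction)
open import Relation.Binary.PropositionalEquality
  using (_≡_; _≢_; refl; sym; trans; cong; cong₂; subst; subst₂; module ≡-Reasoning)

*-∣-* : ∀ {a b u v} → a ∣ₛ u → b ∣ₛ v → a * b ∣ₛ u * v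
*-∣-* {a} {b} (divides k refl) (divides l refl) = divides (k * l) (regroup k a l b)
  where
  regroup : ∀ k a l b → (k * a) * (l * b) ≡ (k * l) * (a * b)
  regroup = solve-∀

congruent-∣ : ∀ {M} a b → M ∣ₛ a - b → (M ∣ₛ a ⇔ M ∣ₛ b)
congruent-∣ {M} a b M∣a-b = mk⇔
  (λ M∣a → subst (M ∣ₛ_) (cancel a b) (Signed.∣m∣n⇒∣m-n M∣a M∣a-b))
  (λ M∣b → subst (M ∣ₛ_) (restore a b) (Signed.∣m∣n⇒∣m+n M∣a-b M∣b))
  where
  cancel : ∀ a b → a - (a - b) ≡ b
  cancel = solve-∀
  restore : ∀ a b → (a - b) + b ≡ a
  restore = solve-∀

module Sequence (p q : ℤ) where

  g : ℕ → ℤ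
  g = G p q

  G-add : ∀ a b →
    g (a ℕ.+ b) ≡ g (suc a) * g b + g a * g (suc b) - p * g a * g b
    × g (suc (a ℕ.+ b)) ≡ g (suc a) * g (suc b) + q * g a * g b
  G-add zero b = start₀ p (g b) (g (suc b)) , start₁ q (g b) (g (suc b))
    where
    start₀ : ∀ p x y → x ≡ + 1 * x + + 0 * y - p * + 0 * x
    start₀ = solve-∀
    start₁ : ∀ q x y → y ≡ + 1 * y + q * + 0 * x
    start₁ = solve-∀
  G-add (suc a) b =
    trans next (step₀ p q (g a) (g (suc a)) (g b) (g (suc b))) ,
    trans (cong₂ (λ u v → p * u + q * v) next this) (step₁ p q (g a) (g (suc a)) (g b) (g (suc b)))
    where
    this = proj₁ (G-add a b)
    next = proj₂ (G-add a b)
    step₀ : ∀ p q x₀ x₁ y₀ y₁ →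
      x₁ * y₁ + q * x₀ * y₀ ≡ (p * x₁ + q * x₀) * y₀ + x₁ * y₁ - p * x₁ * y₀
    step₀ = solve-∀
    step₁ : ∀ p q x₀ x₁ y₀ y₁ →
      p * (x₁ * y₁ + q * x₀ * y₀) + q * (x₁ * y₀ + x₀ * y₁ - p * x₀ * y₀)
      ≡ (p * x₁ + q * x₀) * y₁ + q * x₁ * y₀
    step₁ = solve-∀

  module Multiples (m : ℕ) where

    y : ℤ
    y = g m

    x : ℤ
    x = g (suc m)

    P′ : ℤ
    P′ = + 2 * x - p * y

    Q′ : ℤ
    Q′ = - (x * x - p * x * y - q * y * y)

    H : ℕ → ℤ
    H = G P′ Q′

    step-m : ∀ w → g (m ℕ.+ (m ℕ.+ w)) ≡ P′ * g (m ℕ.+ w) + Q′ * g w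
    step-m w = begin
      g (m ℕ.+ (m ℕ.+ w))
        ≡⟨ proj₁ (G-add m (m ℕ.+ w)) ⟩
      x * g (m ℕ.+ w) + y * g (suc (m ℕ.+ w)) - p * y * g (m ℕ.+ w)
        ≡⟨ cong₂ (λ u v → x * u + y * v - p * y * u) (proj₁ (G-add m w)) (proj₂ (G-add m w)) ⟩
      x * mid + y * (x * g (suc w) + q * y * g w) - p * y * mid
        ≡⟨ regroup p q x y (g w) (g (suc w)) ⟩
      P′ * mid + Q′ * g w
        ≡⟨ cong (λ u → P′ * u + Q′ * g w) (sym (proj₁ (G-add m w))) ⟩
      P′ * g (m ℕ.+ w) + Q′ * g w ∎
      where
      open ≡-Reasoning
      mid = x * g w + y * g (suc w) - p * y * g w
      regroup : ∀ p q x y g₀ g₁ →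
        x * (x * g₀ + y * g₁ - p * y * g₀) + y * (x * g₁ + q * y * g₀) - p * y * (x * g₀ + y * g₁ - p * y * g₀)
        ≡ (+ 2 * x - p * y) * (x * g₀ + y * g₁ - p * y * g₀) + - (x * x - p * x * y - q * y * y) * g₀
      regroup = solve-∀

    G-multiple : ∀ j → g (j *ℕ m) ≡ y * H j × g (suc j *ℕ m) ≡ y * H (suc j)
    G-multiple zero = sym (ℤP.*-zeroʳ y) , trans (cong g (ℕP.+-identityʳ m)) (sym (ℤP.*-identityʳ y))
    G-multiple (suc j) =
      proj₂ (G-multiple j) ,
      trans (step-m (j *ℕ m))
        (trans (cong₂ (λ u v → P′ * u + Q′ * v) (proj₂ (G-multiple j)) (proj₁ (G-multiple j)))
               (factor P′ Q′ y (H j) (H (suc j))))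
      where
      factor : ∀ P Q y a b → P * (y * b) + Q * (y * a) ≡ y * (P * b + Q * a)
      factor = solve-∀

    shift : ℤ → ℤ
    shift c = x - c * y

    shifted-root : ∀ M c → M ∣ₛ + 2 * c - p → M ∣ₛ q + c * c → M ∣ₛ y →
                   (M * M ∣ₛ + 2 * shift c - P′) × (M * M ∣ₛ Q′ + shift c * shift c)
    shifted-root M c M∣2c-p M∣q+c² M∣y =
      subst (M * M ∣ₛ_) (sym (trace p c x y)) (Signed.∣m⇒∣-m (M∣y*[2c-p])) ,
      subst (M * M ∣ₛ_) (sym (norm p q c x y))
        (Signed.∣m∣n⇒∣m+n (Signed.∣m⇒∣-m (Signed.∣n⇒∣m*n x M∣y*[2c-p]))
                          (Signed.∣m⇒∣m*n (q + c * c) (*-∣-* M∣y M∣y)))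
      where
      M∣y*[2c-p] = *-∣-* M∣y M∣2c-p
      trace : ∀ p c x y → + 2 * (x - c * y) - (+ 2 * x - p * y) ≡ - (y * (+ 2 * c - p))
      trace = solve-∀
      norm : ∀ p q c x y → - (x * x - p * x * y - q * y * y) + (x - c * y) * (x - c * y)
             ≡ - (x * (y * (+ 2 * c - p))) + (y * y) * (q + c * c)
      norm = solve-∀

-- Double-root congruence: if c is a double root of X² − PX − Q modulo M
-- (M ∣ 2c − P and M ∣ Q + c²), then G_{n+1}(P,Q) ≡ (n+1)c^n (mod M), as for the
-- sequence attached to (X − c)².
double-root : ∀ M c P Q → M ∣ₛ + 2 * c - P → M ∣ₛ Q + c * c →
              ∀ n → M ∣ₛ G P Q (suc n) - + (suc n) * c ℤ.^ n
double-root M c P Q M∣2c-P M∣Q+c² n = proj₁ (pair n)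
  where
  E : ℕ → ℤ
  E n = G P Q (suc n) - + (suc n) * c ℤ.^ n

  start : ∀ P Q c → (P * + 1 + Q * + 0) - + 2 * (c * + 1) ≡ - (+ 2 * c - P)
  start = solve-∀

  -- E_{n+2} = P·E_{n+1} + Q·E_n − (2c − P)(n+2)c^{n+1} + (Q + c²)(n+1)c^n
  step : ∀ P Q c N C g₁ g₂ →
    (P * g₂ + Q * g₁) - (+ 3 + N) * (c * (c * C)) ≡
    (P * (g₂ - (+ 2 + N) * (c * C)) + Q * (g₁ - (+ 1 + N) * C))
      - (+ 2 * c - P) * ((+ 2 + N) * (c * C)) + (Q + c * c) * ((+ 1 + N) * C)
  step = solve-∀

  pair : ∀ n → (M ∣ₛ E n) × (M ∣ₛ E (suc n))
  pair zero = Signed.∣n⇒∣m*n (+ 0) Signed.∣-refl , subst (M ∣ₛ_) (sym (start P Q c)) (Signed.∣m⇒∣-m M∣2c-P)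
  pair (suc n) =
    proj₂ (pair n) ,
    subst (M ∣ₛ_) (sym (step P Q c (+ n) (c ℤ.^ n) (G P Q (suc n)) (G P Q (suc (suc n)))))
      (Signed.∣m∣n⇒∣m+n
        (Signed.∣m∣n⇒∣m-n
          (Signed.∣m∣n⇒∣m+n (Signed.∣n⇒∣m*n P (proj₂ (pair n))) (Signed.∣n⇒∣m*n Q (proj₁ (pair n))))
          (Signed.∣m⇒∣m*n _ M∣2c-P))
        (Signed.∣m⇒∣m*n _ M∣Q+c²))

coprime-* : ∀ {a b n} → Coprime a n → Coprime b n → Coprime (a *ℕ b) n
coprime-* {a} {b} {n} a⊥n b⊥n {d} (d∣ab , d∣n) = b⊥n (Coprimality.coprime-divisor d⊥a d∣ab , d∣n)
  where
  d⊥a : Coprime d a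
  d⊥a (e∣d , e∣a) = a⊥n (e∣a , ℕD.∣-trans e∣d d∣n)

Unit : ℕ → ℤ → Set
Unit s x = Coprime ∣ x ∣ s

unit-* : ∀ {s} x y → Unit s x → Unit s y → Unit s (x * y)
unit-* x y x-unit y-unit = subst (λ z → Coprime z _) (sym (ℤP.abs-* x y)) (coprime-* x-unit y-unit)

unit-^ : ∀ {s} x → Unit s x → ∀ k → Unit s (x ℤ.^ k)
unit-^ x x-unit zero = Coprimality.1-coprimeTo _
unit-^ x x-unit (suc k) = unit-* x (x ℤ.^ k) x-unit (unit-^ x x-unit k)

unit-modulo-^ : ∀ {s x} → Unit s x → ∀ k → Unit (s ^ k) x
unit-modulo-^ {s} {x} x-unit zero = Coprimality.sym (Coprimality.1-coprimeTo ∣ x ∣)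
unit-modulo-^ {s} {x} x-unit (suc k) =
  Coprimality.sym (coprime-* (Coprimality.sym x-unit) (Coprimality.sym (unit-modulo-^ {s} {x} x-unit k)))

unit-congruent : ∀ {s} a b → + s ∣ₛ a - b → Unit s b → Unit s a
unit-congruent {s} a b s∣a-b b-unit {d} (d∣a , d∣s) = b-unit (Signed.∣⇒∣ᵤ d∣b , d∣s)
  where
  d∣b : + d ∣ₛ b
  d∣b = Equivalence.to (congruent-∣ a b (Signed.∣-trans (Signed.∣ᵤ⇒∣ {+ d} {+ s} d∣s) s∣a-b))
                       (Signed.∣ᵤ⇒∣ {+ d} {a} d∣a)

unit-cancel : ∀ {s} x y → Unit s x → + s ∣ₛ y * x → + s ∣ₛ y
unit-cancel {s} x y x-unit s∣yx = Signed.∣ᵤ⇒∣ {+ s} {y}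
  (Coprimality.coprime-divisor (Coprimality.sym x-unit)
    (subst (s ∣ℕ_) (ℤP.abs-* x y) (Signed.∣⇒∣ᵤ (subst (+ s ∣ₛ_) (ℤP.*-comm y x) s∣yx))))

record DoubleRoot (p q : ℤ) (s : ℕ) : Set where
  field
    c      : ℤ
    s∣2c-p : + s ∣ₛ + 2 * c - p
    s∣q+c² : + s ∣ₛ q + c * c
    c-unit : Unit s c

module WithDoubleRoot (p q : ℤ) (s′ : ℕ) (root : DoubleRoot p q (suc s′)) where
  open DoubleRoot root
  open Sequence p q

  s : ℕ
  s = suc s′

  congruence : ∀ n → + s ∣ₛ g (suc n) - + (suc n) * c ℤ.^ n
  congruence = double-root (+ s) c p q s∣2c-p s∣q+c²

  -- Part (1).  Since c is a unit, s ∣ (n+1)c^n exactly when s ∣ n + 1.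
  s∣n⇔s∣G : ∀ n → (s ∣ℕ n) ⇔ (+ s ∣ g n)
  s∣n⇔s∣G zero = mk⇔ (λ _ → s ℕD.∣0) (λ _ → s ℕD.∣0)
  s∣n⇔s∣G (suc n) = mk⇔
    (λ s∣n+1 → Signed.∣⇒∣ᵤ (from (Signed.∣m⇒∣m*n (c ℤ.^ n) (Signed.∣ᵤ⇒∣ {+ s} {+ suc n} s∣n+1))))
    (λ s∣G → Signed.∣⇒∣ᵤ (unit-cancel (c ℤ.^ n) (+ suc n) (unit-^ c c-unit n)
                                      (to (Signed.∣ᵤ⇒∣ {+ s} {g (suc n)} s∣G))))
    where open Equivalence (congruent-∣ (g (suc n)) _ (congruence n))

  s∣G[st] : ∀ t → + s ∣ₛ g (s *ℕ t)
  s∣G[st] t = Signed.∣ᵤ⇒∣ {+ s} {g (s *ℕ t)} (Equivalence.to (s∣n⇔s∣G (s *ℕ t)) (ℕD.m∣m*n t))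

  -- If s ∣ n then G_{n+1} ≡ c^n (mod s), so G_{n+1} is a unit.
  successor-unit : ∀ n → s ∣ℕ n → Unit s (g (suc n))
  successor-unit n s∣n = unit-congruent (g (suc n)) (c ℤ.^ n)
    (subst (+ s ∣ₛ_) (sym (split (g (suc n)) (+ n) (c ℤ.^ n)))
      (Signed.∣m∣n⇒∣m+n (congruence n) (Signed.∣m⇒∣m*n _ (Signed.∣ᵤ⇒∣ {+ s} {+ n} s∣n))))
    (unit-^ c c-unit n)
    where
    split : ∀ a N C → a - C ≡ (a - (+ 1 + N) * C) + N * C
    split = solve-∀

  -- Indeed
  -- G_{sm} = G_m H_s, and the double-root congruence for H modulo s² at the
  -- root c′ = shift c gives H_s ≡ s c′^{s−1} (mod s²), where c′ ≡ G_{m+1} is a unit.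
  lift-by-s : ∀ m → + s ∣ g m → Σ[ U ∈ ℤ ] g (s *ℕ m) ≡ g m * (+ s * U) × Unit s U
  lift-by-s m s∣Gm = U , trans (proj₁ (G-multiple s)) (cong (y *_) Hs≡sU) , U-unit
    where
    open Multiples m
    S = + s
    s∣y : S ∣ₛ y
    s∣y = Signed.∣ᵤ⇒∣ {S} {y} s∣Gm
    c′ = shift c
    roots = shifted-root S c s∣2c-p s∣q+c² s∣y
    Hs≡ : S * S ∣ₛ H s - S * c′ ℤ.^ s′
    Hs≡ = double-root (S * S) c′ P′ Q′ (proj₁ roots) (proj₂ roots) s′
    w = Signed._∣_.quotient Hs≡
    U = c′ ℤ.^ s′ + w * S
    Hs≡sU : H s ≡ S * U
    Hs≡sU = begin
      H s                                      ≡⟨ restore (H s) (S * c′ ℤ.^ s′) ⟩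
      (H s - S * c′ ℤ.^ s′) + S * c′ ℤ.^ s′    ≡⟨ cong (_+ S * c′ ℤ.^ s′) (Signed._∣_.equality Hs≡) ⟩
      w * (S * S) + S * c′ ℤ.^ s′              ≡⟨ collect w S (c′ ℤ.^ s′) ⟩
      S * U                                    ∎
      where
      open ≡-Reasoning
      restore : ∀ a b → a ≡ (a - b) + b
      restore = solve-∀
      collect : ∀ w S C → w * (S * S) + S * C ≡ S * (C + w * S)
      collect = solve-∀
    c′-unit : Unit s c′
    c′-unit = unit-congruent c′ x
      (subst (S ∣ₛ_) (sym (drop x c y)) (Signed.∣m⇒∣-m (Signed.∣n⇒∣m*n c s∣y)))
      (successor-unit m (Equivalence.from (s∣n⇔s∣G m) s∣Gm))
      where
      drop : ∀ x c y → (x - c * y) - x ≡ - (c * y)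
      drop = solve-∀
    U-unit : Unit s U
    U-unit = unit-congruent U (c′ ℤ.^ s′) (divides w (drop (c′ ℤ.^ s′) w S)) (unit-^ c′ c′-unit s′)
      where
      drop : ∀ C w S → (C + w * S) - C ≡ w * S
      drop = solve-∀

  lift-power : ∀ m → + s ∣ g m → ∀ k → Σ[ U ∈ ℤ ] g (s ^ k *ℕ m) ≡ g m * (+ (s ^ k) * U) × Unit s U
  lift-power m s∣Gm zero =
    + 1 , trans (cong g (ℕP.+-identityʳ m)) (sym (unit-factor (g m))) , Coprimality.1-coprimeTo s
    where
    unit-factor : ∀ a → a * (+ 1 * + 1) ≡ a
    unit-factor = solve-∀
  lift-power m s∣Gm (suc k) = U * V , Gsm≡ , unit-* U V U-unit V-unit
    where
    open ≡-Reasoning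
    m′ = s ^ k *ℕ m
    previous = lift-power m s∣Gm k
    U = proj₁ previous
    Gm′≡ : g m′ ≡ g m * (+ (s ^ k) * U)
    Gm′≡ = proj₁ (proj₂ previous)
    U-unit : Unit s U
    U-unit = proj₂ (proj₂ previous)
    s∣Gm′ : + s ∣ g m′
    s∣Gm′ = Signed.∣⇒∣ᵤ (subst (+ s ∣ₛ_) (sym Gm′≡) (Signed.∣m⇒∣m*n _ (Signed.∣ᵤ⇒∣ {+ s} {g m} s∣Gm)))
    next = lift-by-s m′ s∣Gm′
    V = proj₁ next
    Gsm′≡ : g (s *ℕ m′) ≡ g m′ * (+ s * V)
    Gsm′≡ = proj₁ (proj₂ next)
    V-unit : Unit s V
    V-unit = proj₂ (proj₂ next)
    regroup : ∀ a S K U V → a * (K * U) * (S * V) ≡ a * (S * K * (U * V))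
    regroup = solve-∀
    Gsm≡ : g (s ^ suc k *ℕ m) ≡ g m * (+ (s ^ suc k) * (U * V))
    Gsm≡ = begin
      g (s *ℕ s ^ k *ℕ m)                   ≡⟨ cong g (ℕP.*-assoc s (s ^ k) m) ⟩
      g (s *ℕ m′)                           ≡⟨ Gsm′≡ ⟩
      g m′ * (+ s * V)                      ≡⟨ cong (_* (+ s * V)) Gm′≡ ⟩
      g m * (+ (s ^ k) * U) * (+ s * V)     ≡⟨ regroup (g m) (+ s) (+ (s ^ k)) U V ⟩
      g m * (+ s * + (s ^ k) * (U * V))     ≡⟨ cong (λ z → g m * (z * (U * V))) (sym (ℤP.pos-* s (s ^ k))) ⟩
      g m * (+ (s ^ suc k) * (U * V))       ∎

  reindex : ∀ k t → t *ℕ s ^ suc k ≡ s ^ k *ℕ (s *ℕ t)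
  reindex k t = rearrange s (s ^ k) t
    where
    rearrange : ∀ s K t → t *ℕ (s *ℕ K) ≡ K *ℕ (s *ℕ t)
    rearrange = ℕSolver.solve-∀

  power-to : ∀ k n → s ^ k ∣ℕ n → + (s ^ k) ∣ g n
  power-to zero n _ = ℕD.1∣ _
  power-to (suc k) n (ℕD.divides t refl) = Signed.∣⇒∣ᵤ
    (subst₂ _∣ₛ_ (sym (ℤP.pos-* s (s ^ k))) (sym Gn≡)
      (*-∣-* (s∣G[st] t) (Signed.∣m⇒∣m*n U Signed.∣-refl)))
    where
    lifted = lift-power (s *ℕ t) (Signed.∣⇒∣ᵤ (s∣G[st] t)) k
    U = proj₁ lifted
    Gn≡ : g (t *ℕ s ^ suc k) ≡ g (s *ℕ t) * (+ (s ^ k) * U)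
    Gn≡ = trans (cong g (reindex k t)) (proj₁ (proj₂ lifted))

  -- For n = t·s^{k+1}: s^{k+2} ∣ G_n forces s² ∣ G_{st}, because
  -- G_n = s^k · G_{st} · U with U a unit.
  s²∣G[st] : ∀ k t → + (s ^ suc (suc k)) ∣ g (t *ℕ s ^ suc k) → + (s ^ 2) ∣ g (s *ℕ t)
  s²∣G[st] k t s^k+2∣Gn = Signed.∣⇒∣ᵤ
    (unit-cancel U (g (s *ℕ t)) (unit-modulo-^ {s} {U} (proj₂ (proj₂ lifted)) 2)
      (Signed.*-cancelˡ-∣ (+ (s ^ k)) {{ℕP.m^n≢0 s k}} divisible))
    where
    split-power : + (s ^ suc (suc k)) ≡ + (s ^ k) * + (s ^ 2)
    split-power = trans (cong (λ e → + (s ^ e)) (ℕP.+-comm 2 k))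
                        (trans (cong +_ (ℕP.^-distribˡ-+-* s k 2)) (ℤP.pos-* (s ^ k) (s ^ 2)))
    lifted = lift-power (s *ℕ t) (Signed.∣⇒∣ᵤ (s∣G[st] t)) k
    U = proj₁ lifted
    swap : ∀ a K U → a * (K * U) ≡ K * (a * U)
    swap = solve-∀
    Gn≡′ : g (t *ℕ s ^ suc k) ≡ + (s ^ k) * (g (s *ℕ t) * U)
    Gn≡′ = trans (cong g (reindex k t)) (trans (proj₁ (proj₂ lifted)) (swap (g (s *ℕ t)) (+ (s ^ k)) U))
    divisible : + (s ^ k) * + (s ^ 2) ∣ₛ + (s ^ k) * (g (s *ℕ t) * U)
    divisible = subst₂ _∣ₛ_ split-power Gn≡′ (Signed.∣ᵤ⇒∣ s^k+2∣Gn)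

  Hypothesis : Set
  Hypothesis = (t : ℕ) → 1 ≤ℕ t → ¬ (s ∣ℕ t) → ¬ (+ (s ^ 2) ∣ g (s *ℕ t))

  -- Induction step of part (2): if s^{k+2} ∣ G_n for n = t·s^{k+1}, then s ∣ t,
  -- since otherwise t ≥ 1 and the hypothesis forbids s² ∣ G_{st}.
  power-step : Hypothesis → ∀ k t →
    + (s ^ suc (suc k)) ∣ g (t *ℕ s ^ suc k) → s ^ suc (suc k) ∣ℕ t *ℕ s ^ suc k
  power-step hyp k t s^k+2∣Gn with s ℕD.∣? t
  ... | yes (ℕD.divides t′ t≡) =
    ℕD.divides t′ (trans (cong (_*ℕ s ^ suc k) t≡) (ℕP.*-assoc t′ s (s ^ suc k)))
  ... | no s∤t = contradiction (s²∣G[st] k t s^k+2∣Gn) (hyp t (positive t s∤t) s∤t)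
    where
    positive : ∀ t → ¬ (s ∣ℕ t) → 1 ≤ℕ t
    positive zero s∤0 = contradiction (s ℕD.∣0) s∤0
    positive (suc t) _ = s≤s z≤n

  power-from : Hypothesis → ∀ k n → + (s ^ k) ∣ g n → s ^ k ∣ℕ n
  power-from hyp zero n _ = ℕD.1∣ n
  power-from hyp (suc zero) n s∣Gn =
    subst (_∣ℕ n) (sym (ℕP.*-identityʳ s))
      (Equivalence.from (s∣n⇔s∣G n) (subst (λ z → + z ∣ g n) (ℕP.*-identityʳ s) s∣Gn))
  power-from hyp (suc (suc k)) n s^k+2∣Gn =
    extend (power-from hyp (suc k) n (ℕD.∣-trans (ℕD.n∣m*n s) s^k+2∣Gn))
    where
    extend : s ^ suc k ∣ℕ n → s ^ suc (suc k) ∣ℕ n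
    extend (ℕD.divides t n≡) = subst (s ^ suc (suc k) ∣ℕ_) (sym n≡)
      (power-step hyp k t (subst (λ z → + (s ^ suc (suc k)) ∣ g z) n≡ s^k+2∣Gn))

parity : ∀ x → + 2 ∣ₛ x ⊎ + 2 ∣ₛ x + + 1
parity x with x %ℕ 2 | ℤD.n%ℕd<d x 2 | ℤD.a≡a%ℕn+[a/ℕn]*n x 2
... | 0 | _ | x≡ = inj₁ (divides (x /ℕ 2) (trans x≡ (ℤP.+-identityˡ _)))
... | 1 | _ | x≡ = inj₂ (divides (x /ℕ 2 + + 1) (trans (cong (_+ + 1) x≡) (odd (x /ℕ 2))))
  where
  odd : ∀ h → + 1 + h * + 2 + + 1 ≡ (h + + 1) * + 2
  odd = solve-∀
... | suc (suc _) | s≤s (s≤s ()) | _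

-- Division by d is exact on multiples of d: the remainder is a multiple of d below d.
/ℕ-exact : ∀ d .{{_ : ℕ.NonZero d}} x → + d ∣ₛ x → x ≡ (x /ℕ d) * + d
/ℕ-exact d x d∣x with x %ℕ d | ℤD.n%ℕd<d x d | ℤD.a≡a%ℕn+[a/ℕn]*n x d
... | zero | _ | x≡ = trans x≡ (ℤP.+-identityˡ _)
... | suc r | r<d | x≡ = contradiction (Signed.∣⇒∣ᵤ d∣r+1) (ℕD.>⇒∤ r<d)
  where
  remainder : ∀ a b → (a + b) - b ≡ a
  remainder = solve-∀
  d∣r+1 : + d ∣ₛ + suc r
  d∣r+1 = subst (+ d ∣ₛ_) (trans (cong (_- (x /ℕ d) * + d) x≡) (remainder (+ suc r) ((x /ℕ d) * + d)))
            (Signed.∣m∣n⇒∣m-n d∣x (Signed.∣n⇒∣m*n (x /ℕ d) Signed.∣-refl))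

odd⇒suc-even : ∀ s → ¬ (2 ∣ℕ s) → Σ[ u ∈ ℕ ] suc s ≡ 2 *ℕ u
odd⇒suc-even zero 2∤0 = contradiction (2 ℕD.∣0) 2∤0
odd⇒suc-even (suc zero) _ = 1 , refl
odd⇒suc-even (suc (suc s)) 2∤s+2 with odd⇒suc-even s (λ 2∣s → 2∤s+2 (ℕD.∣m∣n⇒∣m+n (ℕD.∣-refl {2}) 2∣s))
... | u , s+1≡2u = suc u , trans (cong (λ z → suc (suc z)) s+1≡2u) (sym (ℕP.*-suc 2 u))

2∣disc⇒2∣p : ∀ p q → + 2 ∣ₛ p * p + + 4 * q → + 2 ∣ p
2∣disc⇒2∣p p q 2∣r = reduce (euclidsLemma ∣ p ∣ ∣ p ∣ prime[2]
  (subst (2 ∣ℕ_) (ℤP.abs-* p p) (Signed.∣⇒∣ᵤ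
    (subst (+ 2 ∣ₛ_) (sym (square p q)) (Signed.∣m∣n⇒∣m-n 2∣r (Signed.∣m⇒∣m*n (+ 2 * q) Signed.∣-refl))))))
  where
  square : ∀ p q → p * p ≡ (p * p + + 4 * q) - + 2 * (+ 2 * q)
  square = solve-∀

2∣q+q² : ∀ q → + 2 ∣ₛ q + q * q
2∣q+q² q = subst (+ 2 ∣ₛ_) (sym (factor q)) (case (parity q))
  where
  factor : ∀ q → q + q * q ≡ q * (q + + 1)
  factor = solve-∀
  case : + 2 ∣ₛ q ⊎ + 2 ∣ₛ q + + 1 → + 2 ∣ₛ q * (q + + 1)
  case (inj₁ 2∣q) = Signed.∣m⇒∣m*n (q + + 1) 2∣q
  case (inj₂ 2∣q+1) = Signed.∣n⇒∣m*n q 2∣q+1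

gcd≡1⇒common-divisor≡1 : ∀ {a b} d → gcd a b ≡ + 1 → + d ∣ₛ a → + d ∣ₛ b → d ≡ 1
gcd≡1⇒common-divisor≡1 {a} {b} d gcd≡1 d∣a d∣b = ℕD.∣1⇒≡1 (subst (λ z → d ∣ℕ ∣ z ∣) gcd≡1
  (gcd-greatest {a} {b} {+ d} (Signed.∣⇒∣ᵤ d∣a) (Signed.∣⇒∣ᵤ d∣b)))

common-divisor : ∀ {p q s c d} → + s ∣ₛ + 2 * c - p → + s ∣ₛ q + c * c →
                 + d ∣ₛ c → + d ∣ₛ + s → (+ d ∣ₛ p) × (+ d ∣ₛ q)
common-divisor {p} {q} {s} {c} {d} s∣2c-p s∣q+c² d∣c d∣s =
  Equivalence.to (congruent-∣ (+ 2 * c) p (Signed.∣-trans d∣s s∣2c-p)) (Signed.∣n⇒∣m*n (+ 2) d∣c) ,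
  Equivalence.to (congruent-∣ (q + c * c) q (subst (+ d ∣ₛ_) (sym (excess q c)) (Signed.∣n⇒∣m*n c d∣c)))
                 (Signed.∣-trans d∣s s∣q+c²)
  where
  excess : ∀ q c → (q + c * c) - q ≡ c * c
  excess = solve-∀

coprime⇒root-unit : ∀ {p q s c} → gcd p q ≡ + 1 → + s ∣ₛ + 2 * c - p → + s ∣ₛ q + c * c → Unit s c
coprime⇒root-unit {p} {q} {s} {c} gcd≡1 s∣2c-p s∣q+c² {d} (d∣c , d∣s) =
  gcd≡1⇒common-divisor≡1 d gcd≡1 (proj₁ d∣p×d∣q) (proj₂ d∣p×d∣q)
  where
  d∣p×d∣q = common-divisor {p} {q} {s} {c} {d} s∣2c-p s∣q+c²
              (Signed.∣ᵤ⇒∣ {+ d} {c} d∣c) (Signed.∣ᵤ⇒∣ {+ d} {+ s} d∣s)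

-- An odd modulus s ∣ p² + 4q with gcd(p, q) = 1 admits a double root: writing
-- s + 1 = 2u, c = pu has 2c − p = ps and q + c² = u²(p² + 4q) − q·s(s + 2).
odd-modulus-root : ∀ p q s → ¬ (2 ∣ℕ s) → gcd p q ≡ + 1 → + s ∣ₛ p * p + + 4 * q → DoubleRoot p q s
odd-modulus-root p q s 2∤s gcd≡1 s∣r = record
  { c = c ; s∣2c-p = s∣2c-p ; s∣q+c² = s∣q+c² ; c-unit = coprime⇒root-unit {p} {q} {s} {c} gcd≡1 s∣2c-p s∣q+c² }
  where
  open ≡-Reasoning
  u = proj₁ (odd⇒suc-even s 2∤s)
  U = + u
  S = + s
  c = p * U
  2U≡1+S : + 2 * U ≡ + 1 + S
  2U≡1+S = trans (sym (ℤP.pos-* 2 u)) (cong +_ (sym (proj₂ (odd⇒suc-even s 2∤s))))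
  trace : ∀ p U → + 2 * (p * U) - p ≡ p * (+ 2 * U) - p
  trace = solve-∀
  trace′ : ∀ p S → p * (+ 1 + S) - p ≡ p * S
  trace′ = solve-∀
  s∣2c-p : S ∣ₛ + 2 * c - p
  s∣2c-p = divides p (begin
    + 2 * c - p          ≡⟨ trace p U ⟩
    p * (+ 2 * U) - p    ≡⟨ cong (λ z → p * z - p) 2U≡1+S ⟩
    p * (+ 1 + S) - p    ≡⟨ trace′ p S ⟩
    p * S                ∎)
  norm : ∀ p q U → q + (p * U) * (p * U) ≡ (U * U) * (p * p + + 4 * q) - q * ((+ 2 * U) * (+ 2 * U) - + 1)
  norm = solve-∀
  norm′ : ∀ S → (+ 1 + S) * (+ 1 + S) - + 1 ≡ (S + + 2) * S
  norm′ = solve-∀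
  s∣4U²-1 : S ∣ₛ (+ 2 * U) * (+ 2 * U) - + 1
  s∣4U²-1 = divides (S + + 2) (trans (cong (λ z → z * z - + 1) 2U≡1+S) (norm′ S))
  s∣q+c² : S ∣ₛ q + c * c
  s∣q+c² = subst (S ∣ₛ_) (sym (norm p q U))
    (Signed.∣m∣n⇒∣m-n (Signed.∣n⇒∣m*n (U * U) s∣r) (Signed.∣n⇒∣m*n q s∣4U²-1))

-- Case (a): p is odd, so every divisor s of p² + 4q is odd.
odd-p-root : ∀ p q s → ¬ (+ 2 ∣ p) → gcd p q ≡ + 1 → + s ∣ p * p + + 4 * q → DoubleRoot p q s
odd-p-root p q s 2∤p gcd≡1 s∣r = odd-modulus-root p q s 2∤s gcd≡1 s∣ₛr
  where
  s∣ₛr = Signed.∣ᵤ⇒∣ {+ s} {p * p + + 4 * q} s∣r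
  2∤s : ¬ (2 ∣ℕ s)
  2∤s 2∣s = 2∤p (2∣disc⇒2∣p p q (Signed.∣-trans (Signed.∣ᵤ⇒∣ {+ 2} {+ s} 2∣s) s∣ₛr))

-- Case (b): p = 2c, so (p² + 4q)/4 = q + c² and c is a root with 2c − p = 0;
-- a common divisor of c and s divides q, hence is 1.
even-p-root : ∀ p q s → + 2 ∣ p → gcd (p /ℕ 2) q ≡ + 1 → + s ∣ (p * p + + 4 * q) /ℕ 4 → DoubleRoot p q s
even-p-root p q s 2∣p gcd≡1 s∣r/4 = record
  { c = c ; s∣2c-p = s∣2c-p ; s∣q+c² = s∣q+c² ; c-unit = c-unit }
  where
  c = p /ℕ 2
  p≡2c : p ≡ c * + 2
  p≡2c = /ℕ-exact 2 p (Signed.∣ᵤ⇒∣ {+ 2} {p} 2∣p)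
  r = p * p + + 4 * q
  quarter : ∀ c q → (c * + 2) * (c * + 2) + + 4 * q ≡ (q + c * c) * + 4
  quarter = solve-∀
  r≡4[q+c²] : r ≡ (q + c * c) * + 4
  r≡4[q+c²] = trans (cong (λ z → z * z + + 4 * q) p≡2c) (quarter c q)
  r/4≡q+c² : r /ℕ 4 ≡ q + c * c
  r/4≡q+c² = ℤP.*-cancelʳ-≡ _ _ (+ 4) (trans (sym (/ℕ-exact 4 r (divides (q + c * c) r≡4[q+c²]))) r≡4[q+c²])
  vanish : ∀ c → + 2 * c - c * + 2 ≡ + 0
  vanish = solve-∀
  s∣2c-p : + s ∣ₛ + 2 * c - p
  s∣2c-p = subst (λ z → + s ∣ₛ + 2 * c - z) (sym p≡2c)
             (subst (+ s ∣ₛ_) (sym (vanish c)) (Signed.∣n⇒∣m*n (+ 0) Signed.∣-refl))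
  s∣q+c² : + s ∣ₛ q + c * c
  s∣q+c² = subst (+ s ∣ₛ_) r/4≡q+c² (Signed.∣ᵤ⇒∣ {+ s} {r /ℕ 4} s∣r/4)
  c-unit : Unit s c
  c-unit {d} (d∣c , d∣s) = gcd≡1⇒common-divisor≡1 {c} {q} d gcd≡1 d∣ₛc
    (proj₂ (common-divisor {p} {q} {s} {c} {d} s∣2c-p s∣q+c² d∣ₛc (Signed.∣ᵤ⇒∣ {+ d} {+ s} d∣s)))
    where
    d∣ₛc = Signed.∣ᵤ⇒∣ {+ d} {c} d∣c

-- Case (c): an odd prime is an odd modulus; for s = 2, p is even and c = q
-- is a root since q + q² is even.
prime-modulus-root : ∀ p q s → gcd p q ≡ + 1 → Prime s → + s ∣ p * p + + 4 * q → DoubleRoot p q s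
prime-modulus-root p q s gcd≡1 s-prime s∣r with s ℕ.≟ 2
... | yes refl = record
  { c = q ; s∣2c-p = 2∣2q-p ; s∣q+c² = 2∣q+q² q ; c-unit = coprime⇒root-unit {p} {q} {2} {q} gcd≡1 2∣2q-p (2∣q+q² q) }
  where
  2∣2q-p : + 2 ∣ₛ + 2 * q - p
  2∣2q-p = Signed.∣m∣n⇒∣m-n (Signed.∣m⇒∣m*n q Signed.∣-refl)
    (Signed.∣ᵤ⇒∣ {+ 2} {p} (2∣disc⇒2∣p p q (Signed.∣ᵤ⇒∣ {+ 2} {p * p + + 4 * q} s∣r)))
... | no s≢2 = odd-modulus-root p q s 2∤s gcd≡1 (Signed.∣ᵤ⇒∣ {+ s} {p * p + + 4 * q} s∣r)
  where
  2∤s : ¬ (2 ∣ℕ s)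
  2∤s 2∣s with prime⇒irreducible s-prime 2∣s
  ... | inj₁ ()
  ... | inj₂ 2≡s = s≢2 (sym 2≡s)

double-root-exists : ∀ {p q s} →
    ((¬ (+ 2 ∣ p) × gcd p q ≡ + 1 × + s ∣ p * p + + 4 * q)
    ⊎ ((+ 2 ∣ p) × gcd (p /ℕ 2) q ≡ + 1 × + s ∣ (p * p + + 4 * q) /ℕ 4)
    ⊎ (gcd p q ≡ + 1 × Prime s × + s ∣ p * p + + 4 * q)) → DoubleRoot p q s
double-root-exists {p} {q} {s} (inj₁ (2∤p , gcd≡1 , s∣r)) = odd-p-root p q s 2∤p gcd≡1 s∣r
double-root-exists {p} {q} {s} (inj₂ (inj₁ (2∣p , gcd≡1 , s∣r/4))) = even-p-root p q s 2∣p gcd≡1 s∣r/4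
double-root-exists {p} {q} {s} (inj₂ (inj₂ (gcd≡1 , s-prime , s∣r))) = prime-modulus-root p q s gcd≡1 s-prime s∣r

theorem1p2 : (p q : ℤ) (s : ℕ) → 1 ≤ℕ s →
    p * p + + 4 * q ≢ + 0 →
    ((¬ (+ 2 ∣ p) × gcd p q ≡ + 1 × + s ∣ p * p + + 4 * q)
      ⊎ ((+ 2 ∣ p) × gcd (p /ℕ 2) q ≡ + 1 × + s ∣ (p * p + + 4 * q) /ℕ 4)
      ⊎ (gcd p q ≡ + 1 × Prime s × + s ∣ p * p + + 4 * q)) →
    ((n : ℕ) → (s ∣ℕ n) ⇔ (+ s ∣ G p q n))
    × (((t : ℕ) → 1 ≤ℕ t → ¬ (s ∣ℕ t) → ¬ (+ (s ^ 2) ∣ G p q (s *ℕ t)))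
       → (k n : ℕ) → (s ^ k ∣ℕ n) ⇔ (+ (s ^ k) ∣ G p q n))
theorem1p2 p q zero () _ _
theorem1p2 p q (suc s′) (s≤s z≤n) _ cases =
  s∣n⇔s∣G , λ hyp k n → mk⇔ (power-to k n) (power-from hyp k n)
  where open WithDoubleRoot p q s′ (double-root-exists cases)
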